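{- (i) For the molecular graph of (normal) pentane, $\pi_2^*(C_5H_{12})=6$ and $P_2^*(C_5H_{12})=16$. (ii) For the molecular graph $IB$ of isobutane, $\pi_2^*(IB)=5$ and $P_2^*(IB)=7$.
   Context: Molecular graphs have one vertex per atom and one edge per bond. The graph of normal pentane $C_5H_{12}$ is the tree whose carbon vertices $c_1,\dots,c_5$ form a path $c_1c_2c_3c_4c_5$, with $c_1$ and $c_5$ each adjacent to three hydrogen leaves and $c_2,c_3,c_4$ each adjacent to two hydrogen leaves. The graph $IB$ of isobutane (2-methylpropane, $C_4H_{10}$) is the tree with a central carbon adjacent to three other carbons and to one hydrogen leaf, where each of the three other carbons is adjacent to three hydrogen leaves. For a graph $G=(V,E)$, a pebbling configuration is a function $f:V\to\mathbb{N}\cup\{0\}$, of weight $w(f)=\sum_u f(u)$. A pebbling move removes two pebbles from a vertex $u$ and places one pebble on a vertex adjacent to $u$. $f$ is solvable if for every vertex $v$ some (possibly empty) sequence of pebbling moves from $f$ results in at least one pebble on $v$. $f$ is a $2$-restricted pebbling configuration (2RPC) if $f(u)\le2$ for all $u$. $\pi_2^*(G)$ is the minimum weight of a solvable 2RPC on $G$; a $2$-restricted optimal pebbling configuration is a solvable 2RPC of weight $\pi_2^*(G)$, and $P_2^*(G)$ is the number of distinct such configurations. -}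

module Defs where

open import Data.Nat using (ℕ; _+_; _∸_; _≤_; _≥_; suc)
open import Data.Fin using (Fin; #_)
open import Data.Vec using (Vec; lookup; updateAt; foldr; toList)
open import Data.List using (List; length)
open import Data.List.Membership.Propositional using (_∈_)
open import Data.List.Relation.Unary.Unique.Propositional using (Unique)
open import Data.List.Relation.Unary.All using (All)
open import Data.Product using (_×_; Σ; ∃; ∃-syntax; _,_)
open import Data.Sum using (_⊎_)
open import Relation.Binary.PropositionalEquality using (_≡_)
open import Relation.Binary.Construct.Closure.ReflexiveTransitive using (Star)
open import Function.Bundles using (_⇔_)

record Graph : Set where
  field
    n     : ℕ
    edges : List (Fin n × Fin n)
open Graph public

Adj : (G : Graph) → Fin (n G) → Fin (n G) → Set
Adj G u v = ((u , v) ∈ edges G) ⊎ ((v , u) ∈ edges G)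

Config : Graph → Set
Config G = Vec ℕ (n G)

weight : (G : Graph) → Config G → ℕ
weight G f = foldr _ _+_ 0 f

data Move (G : Graph) : Config G → Config G → Set where
  move : (f : Config G) (u v : Fin (n G)) → Adj G u v → lookup f u ≥ 2 →
         Move G f (updateAt (updateAt f u (λ x → x ∸ 2)) v suc)

Reach : (G : Graph) → Config G → Config G → Set
Reach G = Star (Move G)

Solvable : (G : Graph) → Config G → Set
Solvable G f = (v : Fin (n G)) → Σ (Config G) λ g → (Reach G f g × lookup g v ≥ 1)

TwoRestricted : (G : Graph) → Config G → Set
TwoRestricted G f = (u : Fin (n G)) → lookup f u ≤ 2

Pi2Star≡ : Graph → ℕ → Set
Pi2Star≡ G m =
  (Σ (Config G) λ f → TwoRestricted G f × Solvable G f × weight G f ≡ m) ×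
  ((f : Config G) → TwoRestricted G f → Solvable G f → m ≤ weight G f)

Optimal2 : (G : Graph) → ℕ → Config G → Set
Optimal2 G m f = TwoRestricted G f × Solvable G f × weight G f ≡ m

Count≡ : (G : Graph) → ℕ → ℕ → Set
Count≡ G m k = Σ (List (Config G)) λ L →
  Unique L × length L ≡ k × ((f : Config G) → (f ∈ L) ⇔ Optimal2 G m f)

-- Pentane: carbons 0..4 form a path; hydrogens 5..16.
pentane : Graph
pentane = record { n = 17 ; edges =
    (# 0 , # 1) Data.List.∷ (# 1 , # 2) Data.List.∷ (# 2 , # 3) Data.List.∷ (# 3 , # 4) Data.List.∷
    (# 0 , # 5) Data.List.∷ (# 0 , # 6) Data.List.∷ (# 0 , # 7) Data.List.∷
    (# 1 , # 8) Data.List.∷ (# 1 , # 9) Data.List.∷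
    (# 2 , # 10) Data.List.∷ (# 2 , # 11) Data.List.∷
    (# 3 , # 12) Data.List.∷ (# 3 , # 13) Data.List.∷
    (# 4 , # 14) Data.List.∷ (# 4 , # 15) Data.List.∷ (# 4 , # 16) Data.List.∷ Data.List.[] }

-- Isobutane: central carbon 0 adjacent to carbons 1,2,3 and hydrogen 4;
-- carbon 1 has hydrogens 5,6,7; carbon 2 has 8,9,10; carbon 3 has 11,12,13.
isobutane : Graph
isobutane = record { n = 14 ; edges =
    (# 0 , # 1) Data.List.∷ (# 0 , # 2) Data.List.∷ (# 0 , # 3) Data.List.∷ (# 0 , # 4) Data.List.∷
    (# 1 , # 5) Data.List.∷ (# 1 , # 6) Data.List.∷ (# 1 , # 7) Data.List.∷
    (# 2 , # 8) Data.List.∷ (# 2 , # 9) Data.List.∷ (# 2 , # 10) Data.List.∷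
    (# 3 , # 11) Data.List.∷ (# 3 , # 12) Data.List.∷ (# 3 , # 13) Data.List.∷ Data.List.[] }

module Submission where

-- For a target v weigh each vertex u by w_v(u) = 2^(D − d(u,v)). A move trades two pebbles on a for
-- one on a neighbour b, and w_v(b) ≤ 2 w_v(a), so the potential Σ_u f(u) w_v(u) never increases; a
-- configuration that can put a pebble on v thus has potential at least w_v(v). A depth-first
-- enumeration of the 2-restricted configurations of weight at most m, cut off as soon as some target
-- is beyond the reach of the remaining budget, leaves few candidates, and each of them is decided by
-- trying all move sequences (finitely many, since every move loses a pebble). The solvable survivors
-- are exactly the listed configurations, all of weight m.

open import Defs
open import Data.Bool using (Bool; false; T; not; _∧_; _∨_)
open import Data.Bool.ListAction using (any; all)
open import Data.Bool.Properties using (T-∧; T-∨)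
open import Data.Empty using (⊥-elim)
open import Data.Unit using (tt)
open import Data.Fin using (Fin; zero; suc)
open import Data.List using (List; []; _∷_; length; filter; allFin; _++_)
import Data.List as List
open import Data.List.Membership.Propositional using (_∈_; find; lose)
open import Data.List.Membership.Propositional.Properties
  using (∈-allFin; ∈-filter⁺; ∈-map⁺; ∈-map⁻; ∈-++⁺ˡ; ∈-++⁺ʳ; ∈-++⁻)
open import Data.List.Membership.DecPropositional using (_∈?_)
open import Data.List.Relation.Unary.All as All using (All)
open import Data.List.Relation.Unary.All.Properties using (all⁺)
open import Data.List.Relation.Unary.Any using (here; there)
open import Data.List.Relation.Unary.Any.Properties using (any⁺; any⁻)
open import Data.List.Relation.Unary.Unique.Propositional using (Unique)
open import Data.List.Relation.Unary.Unique.DecPropositional using (unique?)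
open import Data.Nat
open import Data.Nat.Properties
open import Algebra.Properties.CommutativeSemigroup +-commutativeSemigroup using (xy∙z≈zy∙x; xy∙z≈xz∙y)
open import Data.Product using (_×_; Σ; ∃; _,_; proj₂; swap)
open import Data.Sum using (_⊎_; inj₁; inj₂)
open import Data.Vec using (Vec; []; _∷_; lookup; updateAt; head; tail; replicate; zipWith; sum)
import Data.Vec as Vec
open import Data.Vec.Properties using (lookup-map; lookup-zipWith; lookup-replicate)
import Data.Vec.Properties as Vecₚ
open import Function using (_∘_; id; mk⇔; Equivalence)
open import Relation.Binary.PropositionalEquality
open import Relation.Binary.Construct.Closure.ReflexiveTransitive using (ε; _◅_)
open import Relation.Nullary using (¬_; yes; no)
open import Relation.Nullary.Decidable using (isYes; toWitness; from-yes)

T-not⇒¬T : ∀ {b} → T (not b) → ¬ T b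
T-not⇒¬T {false} _ ()

module _ {A : Set} (p : A → Bool) where

  T-any⇒∃ : ∀ xs → T (any p xs) → ∃ λ x → x ∈ xs × T (p x)
  T-any⇒∃ xs = find ∘ any⁻ p xs

  ∈⇒T-any : ∀ {x xs} → x ∈ xs → T (p x) → T (any p xs)
  ∈⇒T-any x∈xs px = any⁺ p (lose x∈xs px)

  T-all⇒∈⇒T : ∀ {x xs} → T (all p xs) → x ∈ xs → T (p x)
  T-all⇒∈⇒T {xs = xs} t = All.lookup (all⁺ p xs t)

potential : ∀ {m} → Vec ℕ m → Vec ℕ m → ℕ
potential []       []       = 0
potential (w ∷ ws) (x ∷ xs) = x * w + potential ws xs

maxEntry : ∀ {m} → Vec ℕ m → ℕ
maxEntry []       = 0
maxEntry (w ∷ ws) = w ⊔ maxEntry ws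

potential-∷ : ∀ {m} (w : Vec ℕ (suc m)) x s → potential w (x ∷ s) ≡ x * head w + potential (tail w) s
potential-∷ (w ∷ ws) x s = refl

potential-ones : ∀ {m} (f : Vec ℕ m) → potential (replicate m 1) f ≡ sum f
potential-ones []       = refl
potential-ones (x ∷ xs) = cong₂ _+_ (*-identityʳ x) (potential-ones xs)

lookup≤sum : ∀ {m} (f : Vec ℕ m) i → lookup f i ≤ sum f
lookup≤sum (x ∷ xs) zero    = m≤m+n x (sum xs)
lookup≤sum (x ∷ xs) (suc i) = ≤-trans (lookup≤sum xs i) (m≤n+m (sum xs) x)

lookup*≤potential : ∀ {m} (w f : Vec ℕ m) i → lookup f i * lookup w i ≤ potential w f
lookup*≤potential (w ∷ ws) (x ∷ xs) zero    = m≤m+n (x * w) (potential ws xs)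
lookup*≤potential (w ∷ ws) (x ∷ xs) (suc i) = ≤-trans (lookup*≤potential ws xs i) (m≤n+m _ (x * w))

potential≤sum*max : ∀ {m} (w s : Vec ℕ m) → potential w s ≤ sum s * maxEntry w
potential≤sum*max []       []       = z≤n
potential≤sum*max (w ∷ ws) (x ∷ xs) = begin
    x * w + potential ws xs
  ≤⟨ +-mono-≤ (*-monoʳ-≤ x (m≤m⊔n w (maxEntry ws)))
              (≤-trans (potential≤sum*max ws xs) (*-monoʳ-≤ (sum xs) (m≤n⊔m w (maxEntry ws)))) ⟩
    x * (w ⊔ maxEntry ws) + sum xs * (w ⊔ maxEntry ws)
  ≡⟨ *-distribʳ-+ (w ⊔ maxEntry ws) x (sum xs) ⟨
    (x + sum xs) * (w ⊔ maxEntry ws) ∎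
  where open ≤-Reasoning

-- Stated with both sides increased so that no subtraction occurs.
potential-updateAt : ∀ {m} (w f : Vec ℕ m) i (h : ℕ → ℕ) →
  potential w (updateAt f i h) + lookup f i * lookup w i ≡ potential w f + h (lookup f i) * lookup w i
potential-updateAt (w ∷ ws) (x ∷ xs) zero    h = xy∙z≈zy∙x (h x * w) (potential ws xs) (x * w)
potential-updateAt (w ∷ ws) (x ∷ xs) (suc i) h = begin
  x * w + potential ws (updateAt xs i h) + lookup xs i * lookup ws i
    ≡⟨ +-assoc (x * w) _ _ ⟩
  x * w + (potential ws (updateAt xs i h) + lookup xs i * lookup ws i)
    ≡⟨ cong (x * w +_) (potential-updateAt ws xs i h) ⟩
  x * w + (potential ws xs + h (lookup xs i) * lookup ws i)
    ≡⟨ +-assoc (x * w) _ _ ⟨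
  x * w + potential ws xs + h (lookup xs i) * lookup ws i ∎
  where open ≡-Reasoning

afterMove : ∀ {m} → Vec ℕ m → Fin m → Fin m → Vec ℕ m
afterMove f a b = updateAt (updateAt f a (λ x → x ∸ 2)) b suc

potential-afterMove : ∀ {m} (w f : Vec ℕ m) a b → 2 ≤ lookup f a →
  potential w (afterMove f a b) + 2 * lookup w a ≡ potential w f + lookup w b
potential-afterMove w f a b 2≤fa = begin
    P″ + 2 * wa        ≡⟨ cong (_+ 2 * wa) added ⟩
    P′ + wb + 2 * wa   ≡⟨ xy∙z≈xz∙y P′ wb (2 * wa) ⟩
    P′ + 2 * wa + wb   ≡⟨ cong (_+ wb) removed ⟩
    P + wb ∎
  where
  open ≡-Reasoning
  f′ : Vec ℕ _
  f′ = updateAt f a (λ x → x ∸ 2)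
  wa wb P P′ P″ c k : ℕ
  wa = lookup w a
  wb = lookup w b
  P  = potential w f
  P′ = potential w f′
  P″ = potential w (afterMove f a b)
  c  = lookup f′ b
  k  = lookup f a ∸ 2
  added : P″ ≡ P′ + wb
  added = +-cancelʳ-≡ (c * wb) _ _
    (trans (potential-updateAt w f′ b suc) (sym (+-assoc P′ wb (c * wb))))
  removed : P′ + 2 * wa ≡ P
  removed = +-cancelʳ-≡ (k * wa) _ _ (begin
    P′ + 2 * wa + k * wa   ≡⟨ +-assoc P′ _ _ ⟩
    P′ + (2 * wa + k * wa) ≡⟨ cong (P′ +_) (*-distribʳ-+ wa 2 k) ⟨
    P′ + (2 + k) * wa      ≡⟨ cong (λ y → P′ + y * wa) (m+[n∸m]≡n 2≤fa) ⟩
    P′ + lookup f a * wa   ≡⟨ potential-updateAt w f a (λ x → x ∸ 2) ⟩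
    P + k * wa ∎)

module Pebbling (G : Graph) where

  Vertex : Set
  Vertex = Fin (n G)

  Reaches : Config G → Vertex → Set
  Reaches f v = Σ (Config G) λ g → Reach G f g × lookup g v ≥ 1

  weight-afterMove : ∀ f a b → 2 ≤ lookup f a → suc (weight G (afterMove f a b)) ≡ weight G f
  weight-afterMove f a b 2≤fa = +-cancelʳ-≡ 1 _ _ (trans (sym (+-suc _ 1)) (begin
    weight G (afterMove f a b) + 2              ≡⟨ cong₂ _+_ (potential-ones (afterMove f a b)) (cong (2 *_) (lookup-replicate a 1)) ⟨
    potential ones (afterMove f a b) + 2 * lookup ones a ≡⟨ potential-afterMove ones f a b 2≤fa ⟩
    potential ones f + lookup ones b            ≡⟨ cong₂ _+_ (potential-ones f) (lookup-replicate b 1) ⟩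
    weight G f + 1 ∎))
    where
    open ≡-Reasoning
    ones : Vec ℕ (n G)
    ones = replicate (n G) 1

  arcs : List (Vertex × Vertex)
  arcs = edges G ++ List.map swap (edges G)

  Adj⇒∈arcs : ∀ {a b} → Adj G a b → (a , b) ∈ arcs
  Adj⇒∈arcs (inj₁ ab∈E) = ∈-++⁺ˡ ab∈E
  Adj⇒∈arcs (inj₂ ba∈E) = ∈-++⁺ʳ (edges G) (∈-map⁺ swap ba∈E)

  ∈arcs⇒Adj : ∀ {a b} → (a , b) ∈ arcs → Adj G a b
  ∈arcs⇒Adj ab∈arcs with ∈-++⁻ (edges G) ab∈arcs
  ... | inj₁ ab∈E = inj₁ ab∈E
  ... | inj₂ ab∈swapped with ∈-map⁻ swap ab∈swapped
  ...   | _ , ba∈E , refl = inj₂ ba∈E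

  reachesᵇ : ℕ → Config G → Vertex → Bool
  reachesᵇ zero    f v = 1 ≤ᵇ lookup f v
  reachesᵇ (suc k) f v = (1 ≤ᵇ lookup f v) ∨ any (λ (a , b) → (2 ≤ᵇ lookup f a) ∧ reachesᵇ k (afterMove f a b) v) arcs

  reachesᵇ-sound : ∀ k f v → T (reachesᵇ k f v) → Reaches f v
  reachesᵇ-sound zero    f v t = f , ε , ≤ᵇ⇒≤ 1 _ t
  reachesᵇ-sound (suc k) f v t with Equivalence.to T-∨ t
  ... | inj₁ covered = f , ε , ≤ᵇ⇒≤ 1 _ covered
  ... | inj₂ viaMove with T-any⇒∃ _ arcs viaMove
  ... | (a , b) , ab∈arcs , t′ with Equivalence.to T-∧ t′
  ...   | 2≤fa , rest with reachesᵇ-sound k (afterMove f a b) v rest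
  ...     | g , moves , gv≥1 = g , move f a b (∈arcs⇒Adj ab∈arcs) (≤ᵇ⇒≤ 2 _ 2≤fa) ◅ moves , gv≥1

  -- Every move uses up one pebble, so a move sequence is no longer than the weight.
  reachesᵇ-complete : ∀ k f g v → Reach G f g → lookup g v ≥ 1 → weight G f ≤ k → T (reachesᵇ k f v)
  reachesᵇ-complete zero    f .f v ε gv≥1 _ = ≤⇒≤ᵇ gv≥1
  reachesᵇ-complete (suc k) f .f v ε gv≥1 _ = Equivalence.from T-∨ (inj₁ (≤⇒≤ᵇ gv≥1))
  reachesᵇ-complete zero f g v (move .f a b _ 2≤fa ◅ _) _ w≤0
    with () ← ≤-trans (≤-trans 2≤fa (lookup≤sum f a)) w≤0
  reachesᵇ-complete (suc k) f g v (move .f a b ab 2≤fa ◅ rest) gv≥1 w≤k =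
    Equivalence.from T-∨ (inj₂ (∈⇒T-any _ (Adj⇒∈arcs ab) (Equivalence.from T-∧ (≤⇒≤ᵇ 2≤fa ,
      reachesᵇ-complete k (afterMove f a b) g v rest gv≥1
        (≤-pred (subst (_≤ suc k) (sym (weight-afterMove f a b 2≤fa)) w≤k))))))

  Balanced : Vec ℕ (n G) → Set
  Balanced w = ∀ {a b} → Adj G a b → lookup w b ≤ 2 * lookup w a

  balancedᵇ : Vec ℕ (n G) → Bool
  balancedᵇ w = all (λ (a , b) → lookup w b ≤ᵇ 2 * lookup w a) arcs

  balancedᵇ-sound : ∀ w → T (balancedᵇ w) → Balanced w
  balancedᵇ-sound w t ab = ≤ᵇ⇒≤ _ _ (T-all⇒∈⇒T _ t (Adj⇒∈arcs ab))

  module _ {w : Vec ℕ (n G)} (balanced : Balanced w) where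

    potential-Move : ∀ {f g} → Move G f g → potential w g ≤ potential w f
    potential-Move (move f a b ab 2≤fa) = +-cancelʳ-≤ (2 * lookup w a) _ _ (begin
      potential w (afterMove f a b) + 2 * lookup w a ≡⟨ potential-afterMove w f a b 2≤fa ⟩
      potential w f + lookup w b                     ≤⟨ +-monoʳ-≤ (potential w f) (balanced ab) ⟩
      potential w f + 2 * lookup w a ∎)
      where open ≤-Reasoning

    potential-Reach : ∀ {f g} → Reach G f g → potential w g ≤ potential w f
    potential-Reach ε              = ≤-refl
    potential-Reach (step ◅ steps) = ≤-trans (potential-Reach steps) (potential-Move step)

    Reaches⇒≤potential : ∀ {f v} → Reaches f v → lookup w v ≤ potential w f
    Reaches⇒≤potential {f} {v} (g , steps , gv≥1) = begin
      lookup w v              ≡⟨ *-identityˡ (lookup w v) ⟨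
      1 * lookup w v          ≤⟨ *-monoˡ-≤ (lookup w v) gv≥1 ⟩
      lookup g v * lookup w v ≤⟨ lookup*≤potential w g v ⟩
      potential w g           ≤⟨ potential-Reach steps ⟩
      potential w f ∎
      where open ≤-Reasoning

  optimalᵇ : ℕ → Config G → Bool
  optimalᵇ m f = all (λ u → lookup f u ≤ᵇ 2) (allFin _) ∧ (weight G f ≡ᵇ m)
               ∧ all (reachesᵇ (weight G f) f) (allFin _)

  optimalᵇ-sound : ∀ m f → T (optimalᵇ m f) → Optimal2 G m f
  optimalᵇ-sound m f t with Equivalence.to T-∧ t
  ... | restricted , t₂₃ with Equivalence.to T-∧ t₂₃
  ...   | weight≡m , reaches =
    (λ u → ≤ᵇ⇒≤ _ _ (T-all⇒∈⇒T _ restricted (∈-allFin u))) ,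
    (λ v → reachesᵇ-sound (weight G f) f v (T-all⇒∈⇒T (reachesᵇ (weight G f) f) reaches (∈-allFin v))) ,
    ≡ᵇ⇒≡ _ _ weight≡m

module BranchAndBound (G : Graph) (W : Vec (Vec ℕ (n G)) (n G)) (L : List (Config G)) where
  open Pebbling G

  Verdict : Config G → Set
  Verdict f = (∃ λ v → ¬ Reaches f v) ⊎ f ∈ L

  settledᵇ : Config G → Bool
  settledᵇ f = isYes (_∈?_ (Vecₚ.≡-dec _≟_) f L) ∨ any (λ v → not (reachesᵇ (weight G f) f v)) (allFin _)

  settledᵇ-sound : ∀ f → T (settledᵇ f) → Verdict f
  settledᵇ-sound f t with Equivalence.to T-∨ t
  ... | inj₁ listed = inj₂ (toWitness {a? = _∈?_ (Vecₚ.≡-dec _≟_) f L} listed)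
  ... | inj₂ stuck with T-any⇒∃ _ (allFin _) stuck
  ...   | v , _ , unreached = inj₁ (v , λ (g , steps , gv≥1) →
          T-not⇒¬T unreached (reachesᵇ-complete (weight G f) f g v steps gv≥1 ≤-refl))

  -- A partial assignment: the first coordinates are fixed and baked into `complete`;
  -- `acc` holds their potential for each target and `Ws` the weights of the free coordinates.
  Splits : ∀ {m} → (Vec ℕ m → Config G) → Vec (Vec ℕ m) (n G) → Vec ℕ (n G) → Set
  Splits complete Ws acc =
    ∀ s v → potential (lookup W v) (complete s) ≡ lookup acc v + potential (lookup Ws v) s

  fixHead : ℕ → ∀ {m} → Vec (Vec ℕ (suc m)) (n G) → Vec ℕ (n G) → Vec ℕ (n G)
  fixHead x Ws acc = zipWith (λ a w → a + x * head w) acc Ws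

  Splits-fixHead : ∀ {m} {complete : Vec ℕ (suc m) → Config G} {Ws acc} x → Splits complete Ws acc →
    Splits (complete ∘ (x ∷_)) (Vec.map tail Ws) (fixHead x Ws acc)
  Splits-fixHead {complete = complete} {Ws} {acc} x split s v = begin
    potential (lookup W v) (complete (x ∷ s))
      ≡⟨ split (x ∷ s) v ⟩
    lookup acc v + potential (lookup Ws v) (x ∷ s)
      ≡⟨ cong (lookup acc v +_) (potential-∷ (lookup Ws v) x s) ⟩
    lookup acc v + (x * head (lookup Ws v) + potential (tail (lookup Ws v)) s)
      ≡⟨ +-assoc (lookup acc v) _ _ ⟨
    lookup acc v + x * head (lookup Ws v) + potential (tail (lookup Ws v)) s
      ≡⟨ cong₂ (λ a w → a + potential w s) (lookup-zipWith _ v acc Ws) (lookup-map v tail Ws) ⟨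
    lookup (fixHead x Ws acc) v + potential (lookup (Vec.map tail Ws) v) s ∎
    where open ≡-Reasoning

  -- With budget r left, the potential towards v can grow by at most r times the largest free weight.
  hopelessᵇ : ∀ {m} → Vec (Vec ℕ m) (n G) → Vec ℕ (n G) → ℕ → Bool
  hopelessᵇ Ws acc r =
    any (λ v → lookup acc v + r * maxEntry (lookup Ws v) <ᵇ lookup (lookup W v) v) (allFin _)

  search : (m : ℕ) → (Vec ℕ m → Config G) → Vec (Vec ℕ m) (n G) → Vec ℕ (n G) → ℕ → Bool
  search zero    complete Ws acc r = hopelessᵇ Ws acc r ∨ settledᵇ (complete [])
  search (suc m) complete Ws acc r = hopelessᵇ Ws acc r ∨
    all (λ x → search m (complete ∘ (x ∷_)) (Vec.map tail Ws) (fixHead x Ws acc) (r ∸ x))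
        (filter (_≤? r) (0 ∷ 1 ∷ 2 ∷ []))

  module _ (balanced : ∀ v → Balanced (lookup W v)) where

    hopelessᵇ-sound : ∀ {m} {complete : Vec ℕ m → Config G} {Ws acc r} → Splits complete Ws acc →
      T (hopelessᵇ Ws acc r) → ∀ s → sum s ≤ r → ∃ λ v → ¬ Reaches (complete s) v
    hopelessᵇ-sound {complete = complete} {Ws} {acc} {r} split t s s≤r with T-any⇒∃ _ (allFin _) t
    ... | v , _ , short = v , λ reaches → <⇒≱ (<ᵇ⇒< _ _ short) (begin
      lookup (lookup W v) v                                  ≤⟨ Reaches⇒≤potential {lookup W v} (balanced v) reaches ⟩
      potential (lookup W v) (complete s)                    ≡⟨ split s v ⟩
      lookup acc v + potential (lookup Ws v) s               ≤⟨ +-monoʳ-≤ (lookup acc v) (potential≤sum*max (lookup Ws v) s) ⟩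
      lookup acc v + sum s * maxEntry (lookup Ws v)          ≤⟨ +-monoʳ-≤ (lookup acc v) (*-monoˡ-≤ (maxEntry (lookup Ws v)) s≤r) ⟩
      lookup acc v + r * maxEntry (lookup Ws v) ∎)
      where open ≤-Reasoning

    search-sound : ∀ m {complete : Vec ℕ m → Config G} {Ws acc r} → Splits complete Ws acc →
      T (search m complete Ws acc r) → ∀ s → (∀ i → lookup s i ≤ 2) → sum s ≤ r → Verdict (complete s)
    search-sound zero {Ws = Ws} {acc} {r} split t [] _ s≤r with Equivalence.to (T-∨ {hopelessᵇ Ws acc r}) t
    ... | inj₁ hopeless = inj₁ (hopelessᵇ-sound {Ws = Ws} {acc} {r} split hopeless [] s≤r)
    ... | inj₂ settled  = settledᵇ-sound _ settled
    search-sound (suc m) {Ws = Ws} {acc} {r} split t (x ∷ s) s≤2 x+s≤r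
      with Equivalence.to (T-∨ {hopelessᵇ Ws acc r}) t
    ... | inj₁ hopeless = inj₁ (hopelessᵇ-sound {Ws = Ws} {acc} {r} split hopeless (x ∷ s) x+s≤r)
    ... | inj₂ branches =
      search-sound m (Splits-fixHead {Ws = Ws} {acc} x split)
        (T-all⇒∈⇒T _ branches (∈-filter⁺ (_≤? r) (digit (s≤2 zero)) (m+n≤o⇒m≤o x x+s≤r)))
        s (s≤2 ∘ suc) (subst (_≤ r ∸ x) (m+n∸m≡n x (sum s)) (∸-monoˡ-≤ x x+s≤r))
      where
      digit : ∀ {x} → x ≤ 2 → x ∈ 0 ∷ 1 ∷ 2 ∷ []
      digit z≤n             = here refl
      digit (s≤s z≤n)       = there (here refl)
      digit (s≤s (s≤s z≤n)) = there (there (here refl))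

    classify : ∀ {m} → T (search (n G) id W (replicate _ 0) m) →
      ∀ f → TwoRestricted G f → weight G f ≤ m → Verdict f
    classify t = search-sound (n G) (λ s v → cong (_+ potential (lookup W v) s) (sym (lookup-replicate v 0))) t

  census : ∀ m k {f₀} →
    T (all (balancedᵇ ∘ lookup W) (allFin _)) → T (search (n G) id W (replicate _ 0) m) →
    T (all (optimalᵇ m) L) → Unique L → length L ≡ k → f₀ ∈ L →
    Pi2Star≡ G m × Count≡ G m k
  census m k {f₀} balanced searched optimal unique length≡k f₀∈L =
    ((f₀ , listed⇒optimal f₀∈L) , lowerBound) , (L , unique , length≡k , λ f → mk⇔ listed⇒optimal (optimal⇒listed f))
    where
    verdict : ∀ f → TwoRestricted G f → weight G f ≤ m → Verdict f
    verdict = classify (λ v → balancedᵇ-sound (lookup W v) (T-all⇒∈⇒T _ balanced (∈-allFin v))) searched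

    listed⇒optimal : ∀ {f} → f ∈ L → Optimal2 G m f
    listed⇒optimal f∈L = optimalᵇ-sound m _ (T-all⇒∈⇒T _ optimal f∈L)

    solvable⇒listed : ∀ f → TwoRestricted G f → Solvable G f → weight G f ≤ m → f ∈ L
    solvable⇒listed f restricted solvable w≤m with verdict f restricted w≤m
    ... | inj₁ (v , unreachable) = ⊥-elim (unreachable (solvable v))
    ... | inj₂ f∈L = f∈L

    optimal⇒listed : ∀ f → Optimal2 G m f → f ∈ L
    optimal⇒listed f (restricted , solvable , weight≡m) =
      solvable⇒listed f restricted solvable (≤-reflexive weight≡m)

    lowerBound : ∀ f → TwoRestricted G f → Solvable G f → m ≤ weight G f
    lowerBound f restricted solvable with m ≤? weight G f
    ... | yes m≤w = m≤w
    ... | no m≰w  = ⊥-elim (m≰w (≤-reflexive (sym (proj₂ (proj₂ (listed⇒optimal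
                      (solvable⇒listed f restricted solvable (<⇒≤ (≰⇒> m≰w)))))))))

-- Target v weighs vertex u by 2^(D − d(u,v)), D the diameter: neighbours' weights differ by a factor ≤ 2.
distanceWeights : ∀ {m} → ℕ → Vec (Vec ℕ m) m → Vec (Vec ℕ m) m
distanceWeights D = Vec.map (Vec.map (λ d → 2 ^ (D ∸ d)))

carbonsOnly : ∀ {c} h → Vec ℕ c → Vec ℕ (c + h)
carbonsOnly h pebbles = pebbles Vec.++ replicate h 0

pentaneDistances : Vec (Vec ℕ 17) 17
pentaneDistances =
  (0 ∷ 1 ∷ 2 ∷ 3 ∷ 4 ∷ 1 ∷ 1 ∷ 1 ∷ 2 ∷ 2 ∷ 3 ∷ 3 ∷ 4 ∷ 4 ∷ 5 ∷ 5 ∷ 5 ∷ []) ∷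
  (1 ∷ 0 ∷ 1 ∷ 2 ∷ 3 ∷ 2 ∷ 2 ∷ 2 ∷ 1 ∷ 1 ∷ 2 ∷ 2 ∷ 3 ∷ 3 ∷ 4 ∷ 4 ∷ 4 ∷ []) ∷
  (2 ∷ 1 ∷ 0 ∷ 1 ∷ 2 ∷ 3 ∷ 3 ∷ 3 ∷ 2 ∷ 2 ∷ 1 ∷ 1 ∷ 2 ∷ 2 ∷ 3 ∷ 3 ∷ 3 ∷ []) ∷
  (3 ∷ 2 ∷ 1 ∷ 0 ∷ 1 ∷ 4 ∷ 4 ∷ 4 ∷ 3 ∷ 3 ∷ 2 ∷ 2 ∷ 1 ∷ 1 ∷ 2 ∷ 2 ∷ 2 ∷ []) ∷
  (4 ∷ 3 ∷ 2 ∷ 1 ∷ 0 ∷ 5 ∷ 5 ∷ 5 ∷ 4 ∷ 4 ∷ 3 ∷ 3 ∷ 2 ∷ 2 ∷ 1 ∷ 1 ∷ 1 ∷ []) ∷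
  (1 ∷ 2 ∷ 3 ∷ 4 ∷ 5 ∷ 0 ∷ 2 ∷ 2 ∷ 3 ∷ 3 ∷ 4 ∷ 4 ∷ 5 ∷ 5 ∷ 6 ∷ 6 ∷ 6 ∷ []) ∷
  (1 ∷ 2 ∷ 3 ∷ 4 ∷ 5 ∷ 2 ∷ 0 ∷ 2 ∷ 3 ∷ 3 ∷ 4 ∷ 4 ∷ 5 ∷ 5 ∷ 6 ∷ 6 ∷ 6 ∷ []) ∷
  (1 ∷ 2 ∷ 3 ∷ 4 ∷ 5 ∷ 2 ∷ 2 ∷ 0 ∷ 3 ∷ 3 ∷ 4 ∷ 4 ∷ 5 ∷ 5 ∷ 6 ∷ 6 ∷ 6 ∷ []) ∷
  (2 ∷ 1 ∷ 2 ∷ 3 ∷ 4 ∷ 3 ∷ 3 ∷ 3 ∷ 0 ∷ 2 ∷ 3 ∷ 3 ∷ 4 ∷ 4 ∷ 5 ∷ 5 ∷ 5 ∷ []) ∷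
  (2 ∷ 1 ∷ 2 ∷ 3 ∷ 4 ∷ 3 ∷ 3 ∷ 3 ∷ 2 ∷ 0 ∷ 3 ∷ 3 ∷ 4 ∷ 4 ∷ 5 ∷ 5 ∷ 5 ∷ []) ∷
  (3 ∷ 2 ∷ 1 ∷ 2 ∷ 3 ∷ 4 ∷ 4 ∷ 4 ∷ 3 ∷ 3 ∷ 0 ∷ 2 ∷ 3 ∷ 3 ∷ 4 ∷ 4 ∷ 4 ∷ []) ∷
  (3 ∷ 2 ∷ 1 ∷ 2 ∷ 3 ∷ 4 ∷ 4 ∷ 4 ∷ 3 ∷ 3 ∷ 2 ∷ 0 ∷ 3 ∷ 3 ∷ 4 ∷ 4 ∷ 4 ∷ []) ∷
  (4 ∷ 3 ∷ 2 ∷ 1 ∷ 2 ∷ 5 ∷ 5 ∷ 5 ∷ 4 ∷ 4 ∷ 3 ∷ 3 ∷ 0 ∷ 2 ∷ 3 ∷ 3 ∷ 3 ∷ []) ∷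
  (4 ∷ 3 ∷ 2 ∷ 1 ∷ 2 ∷ 5 ∷ 5 ∷ 5 ∷ 4 ∷ 4 ∷ 3 ∷ 3 ∷ 2 ∷ 0 ∷ 3 ∷ 3 ∷ 3 ∷ []) ∷
  (5 ∷ 4 ∷ 3 ∷ 2 ∷ 1 ∷ 6 ∷ 6 ∷ 6 ∷ 5 ∷ 5 ∷ 4 ∷ 4 ∷ 3 ∷ 3 ∷ 0 ∷ 2 ∷ 2 ∷ []) ∷
  (5 ∷ 4 ∷ 3 ∷ 2 ∷ 1 ∷ 6 ∷ 6 ∷ 6 ∷ 5 ∷ 5 ∷ 4 ∷ 4 ∷ 3 ∷ 3 ∷ 2 ∷ 0 ∷ 2 ∷ []) ∷
  (5 ∷ 4 ∷ 3 ∷ 2 ∷ 1 ∷ 6 ∷ 6 ∷ 6 ∷ 5 ∷ 5 ∷ 4 ∷ 4 ∷ 3 ∷ 3 ∷ 2 ∷ 2 ∷ 0 ∷ []) ∷ []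

pentaneOptimal : List (Config pentane)
pentaneOptimal = List.map (carbonsOnly 12)
  ( (1 ∷ 1 ∷ 1 ∷ 1 ∷ 2 ∷ []) ∷ (1 ∷ 1 ∷ 1 ∷ 2 ∷ 1 ∷ []) ∷ (1 ∷ 1 ∷ 2 ∷ 0 ∷ 2 ∷ []) ∷ (1 ∷ 1 ∷ 2 ∷ 1 ∷ 1 ∷ []) ∷
    (1 ∷ 2 ∷ 0 ∷ 1 ∷ 2 ∷ []) ∷ (1 ∷ 2 ∷ 0 ∷ 2 ∷ 1 ∷ []) ∷ (1 ∷ 2 ∷ 1 ∷ 0 ∷ 2 ∷ []) ∷ (1 ∷ 2 ∷ 1 ∷ 1 ∷ 1 ∷ []) ∷
    (2 ∷ 0 ∷ 1 ∷ 1 ∷ 2 ∷ []) ∷ (2 ∷ 0 ∷ 1 ∷ 2 ∷ 1 ∷ []) ∷ (2 ∷ 0 ∷ 2 ∷ 0 ∷ 2 ∷ []) ∷ (2 ∷ 0 ∷ 2 ∷ 1 ∷ 1 ∷ []) ∷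
    (2 ∷ 1 ∷ 0 ∷ 1 ∷ 2 ∷ []) ∷ (2 ∷ 1 ∷ 0 ∷ 2 ∷ 1 ∷ []) ∷ (2 ∷ 1 ∷ 1 ∷ 0 ∷ 2 ∷ []) ∷ (2 ∷ 1 ∷ 1 ∷ 1 ∷ 1 ∷ []) ∷ [] )

pentaneCensus : Pi2Star≡ pentane 6 × Count≡ pentane 6 16
pentaneCensus = BranchAndBound.census pentane (distanceWeights 6 pentaneDistances) pentaneOptimal
  6 16 tt tt tt (from-yes (unique? (Vecₚ.≡-dec _≟_) pentaneOptimal)) refl (here refl)

isobutaneDistances : Vec (Vec ℕ 14) 14
isobutaneDistances =
  (0 ∷ 1 ∷ 1 ∷ 1 ∷ 1 ∷ 2 ∷ 2 ∷ 2 ∷ 2 ∷ 2 ∷ 2 ∷ 2 ∷ 2 ∷ 2 ∷ []) ∷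
  (1 ∷ 0 ∷ 2 ∷ 2 ∷ 2 ∷ 1 ∷ 1 ∷ 1 ∷ 3 ∷ 3 ∷ 3 ∷ 3 ∷ 3 ∷ 3 ∷ []) ∷
  (1 ∷ 2 ∷ 0 ∷ 2 ∷ 2 ∷ 3 ∷ 3 ∷ 3 ∷ 1 ∷ 1 ∷ 1 ∷ 3 ∷ 3 ∷ 3 ∷ []) ∷
  (1 ∷ 2 ∷ 2 ∷ 0 ∷ 2 ∷ 3 ∷ 3 ∷ 3 ∷ 3 ∷ 3 ∷ 3 ∷ 1 ∷ 1 ∷ 1 ∷ []) ∷
  (1 ∷ 2 ∷ 2 ∷ 2 ∷ 0 ∷ 3 ∷ 3 ∷ 3 ∷ 3 ∷ 3 ∷ 3 ∷ 3 ∷ 3 ∷ 3 ∷ []) ∷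
  (2 ∷ 1 ∷ 3 ∷ 3 ∷ 3 ∷ 0 ∷ 2 ∷ 2 ∷ 4 ∷ 4 ∷ 4 ∷ 4 ∷ 4 ∷ 4 ∷ []) ∷
  (2 ∷ 1 ∷ 3 ∷ 3 ∷ 3 ∷ 2 ∷ 0 ∷ 2 ∷ 4 ∷ 4 ∷ 4 ∷ 4 ∷ 4 ∷ 4 ∷ []) ∷
  (2 ∷ 1 ∷ 3 ∷ 3 ∷ 3 ∷ 2 ∷ 2 ∷ 0 ∷ 4 ∷ 4 ∷ 4 ∷ 4 ∷ 4 ∷ 4 ∷ []) ∷
  (2 ∷ 3 ∷ 1 ∷ 3 ∷ 3 ∷ 4 ∷ 4 ∷ 4 ∷ 0 ∷ 2 ∷ 2 ∷ 4 ∷ 4 ∷ 4 ∷ []) ∷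
  (2 ∷ 3 ∷ 1 ∷ 3 ∷ 3 ∷ 4 ∷ 4 ∷ 4 ∷ 2 ∷ 0 ∷ 2 ∷ 4 ∷ 4 ∷ 4 ∷ []) ∷
  (2 ∷ 3 ∷ 1 ∷ 3 ∷ 3 ∷ 4 ∷ 4 ∷ 4 ∷ 2 ∷ 2 ∷ 0 ∷ 4 ∷ 4 ∷ 4 ∷ []) ∷
  (2 ∷ 3 ∷ 3 ∷ 1 ∷ 3 ∷ 4 ∷ 4 ∷ 4 ∷ 4 ∷ 4 ∷ 4 ∷ 0 ∷ 2 ∷ 2 ∷ []) ∷
  (2 ∷ 3 ∷ 3 ∷ 1 ∷ 3 ∷ 4 ∷ 4 ∷ 4 ∷ 4 ∷ 4 ∷ 4 ∷ 2 ∷ 0 ∷ 2 ∷ []) ∷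
  (2 ∷ 3 ∷ 3 ∷ 1 ∷ 3 ∷ 4 ∷ 4 ∷ 4 ∷ 4 ∷ 4 ∷ 4 ∷ 2 ∷ 2 ∷ 0 ∷ []) ∷ []

isobutaneOptimal : List (Config isobutane)
isobutaneOptimal = List.map (carbonsOnly 10)
  ( (0 ∷ 1 ∷ 2 ∷ 2 ∷ []) ∷ (0 ∷ 2 ∷ 1 ∷ 2 ∷ []) ∷ (0 ∷ 2 ∷ 2 ∷ 1 ∷ []) ∷
    (1 ∷ 1 ∷ 1 ∷ 2 ∷ []) ∷ (1 ∷ 1 ∷ 2 ∷ 1 ∷ []) ∷ (1 ∷ 2 ∷ 1 ∷ 1 ∷ []) ∷
    (2 ∷ 1 ∷ 1 ∷ 1 ∷ []) ∷ [] )

isobutaneCensus : Pi2Star≡ isobutane 5 × Count≡ isobutane 5 7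
isobutaneCensus = BranchAndBound.census isobutane (distanceWeights 4 isobutaneDistances) isobutaneOptimal
  5 7 tt tt tt (from-yes (unique? (Vecₚ.≡-dec _≟_) isobutaneOptimal)) refl (here refl)

mainTheorem7 : (Pi2Star≡ pentane 6 × Count≡ pentane 6 16) × (Pi2Star≡ isobutane 5 × Count≡ isobutane 5 7)
mainTheorem7 = pentaneCensus , isobutaneCensus
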